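{- Let $T$ be a text of length $n$ over $\Sigma$ and consider its implicit suffix tree. Let $(u,d)$ be an implicit node and $S:=\mathrm{str}(u)[1\ldots d]$. If $S$ is not the longest repeated suffix of $T$ and $(u,d)$ does not coincide with a branching node (i.e. $d<\mathrm{depth}(u)$), then $\phi(S)=0$.
   Context: $\Sigma$ is a constant-size alphabet. $T[i\ldots j]$ is the substring from position $i$ to $j$; $f(P)$ is the number of occurrences of $P$ in $T$; a suffix of $T$ is repeated if $f\ge 2$ for it. Net frequency: an occurrence $(i,j)$ is a net occurrence if $f(T[i\ldots j])\ge 2$, $f(T[i-1\ldots j])=1$ and $f(T[i\ldots j+1])=1$, where the second condition is considered true when $i=1$ and the third when $j=n$; $\phi(S)$ is the number of net occurrences $(i,j)$ with $T[i\ldots j]=S$. The implicit suffix tree of $T$ is the compacted trie of all suffixes of $T$ (no sentinel): from the trie of all suffixes, keep as explicit nodes only the root, the branching nodes (non-root nodes with at least two children) and the leaves (trie nodes with no children), compressing every other path into a single labelled edge. For a node $u$: $\mathrm{str}(u)$ is the concatenated edge labels from the root to $u$, $\mathrm{depth}(u)=|\mathrm{str}(u)|$. A locus is a pair $(u,d)$, $u$ non-root, with $\mathrm{depth}(\mathrm{parent}(u))<d\le\mathrm{depth}(u)$, representing $\mathrm{str}(u)[1\ldots d]$. An implicit node is a locus $(u,d)$ such that $\mathrm{str}(u)[1\ldots d]$ is a repeated suffix of $T$. -}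

module Defs where

open import Data.Nat using (ℕ; zero; suc; _+_; _≤_; _<_; _≤?_)
import Data.Nat as ℕ
open import Data.Fin using (Fin)
import Data.Fin as F
open import Data.List using (List; []; _∷_; _∷ʳ_; length; take; drop; filter; upTo; allFin)
open import Data.List.Properties using (≡-dec)
open import Data.Product using (Σ; ∃; _×_)
open import Data.Sum using (_⊎_)
open import Data.Unit using (⊤)
open import Relation.Nullary using (¬_; Dec; yes)
open import Relation.Nullary.Decidable using (_×-dec_; _⊎-dec_)
open import Relation.Binary.PropositionalEquality using (_≡_; _≢_)

-- Positions are 0-based: an occurrence of P in T at position i means
-- T[i .. i+|P|-1] = P (0-based), i.e. take |P| (drop i T) ≡ P and i + |P| ≤ |T|.

module _ {σ : ℕ} where

  Str : Set
  Str = List (Fin σ)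

  _≟s_ : (x y : Str) → Dec (x ≡ y)
  _≟s_ = ≡-dec F._≟_

  OccAt : Str → Str → ℕ → Set
  OccAt T P i = (take (length P) (drop i T) ≡ P) × (i + length P ≤ length T)

  occAt? : (T P : Str) (i : ℕ) → Dec (OccAt T P i)
  occAt? T P i = (take (length P) (drop i T) ≟s P) ×-dec (i + length P ≤? length T)

  f : Str → Str → ℕ
  f T P = length (filter (occAt? T P) (upTo (suc (length T))))

  RepeatedSuffix : Str → Str → Set
  RepeatedSuffix T S = (∃ λ i → drop i T ≡ S) × (2 ≤ f T S)

  LongestRepeatedSuffix : Str → Str → Set
  LongestRepeatedSuffix T S =
    RepeatedSuffix T S × (∀ S′ → RepeatedSuffix T S′ → length S′ ≤ length S)

  -- The occurrence of S at 0-based position i is the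
  -- paper's occurrence (i+1, i+|S|).  Left condition: i is the first
  -- position, or the one-character left extension T[i-1 .. i+|S|-1] is unique.
  LeftOK : Str → Str → ℕ → Set
  LeftOK T S zero    = ⊤
  LeftOK T S (suc i) = f T (take (suc (length S)) (drop i T)) ≡ 1

  leftOK? : (T S : Str) (i : ℕ) → Dec (LeftOK T S i)
  leftOK? T S zero    = yes _
  leftOK? T S (suc i) = f T (take (suc (length S)) (drop i T)) ℕ.≟ 1

  RightOK : Str → Str → ℕ → Set
  RightOK T S i = (i + length S ≡ length T) ⊎ (f T (take (suc (length S)) (drop i T)) ≡ 1)

  rightOK? : (T S : Str) (i : ℕ) → Dec (RightOK T S i)
  rightOK? T S i = (i + length S ℕ.≟ length T) ⊎-dec (f T (take (suc (length S)) (drop i T)) ℕ.≟ 1)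

  NetOcc : Str → Str → ℕ → Set
  NetOcc T S i = OccAt T S i × (2 ≤ f T S) × LeftOK T S i × RightOK T S i

  netOcc? : (T S : Str) (i : ℕ) → Dec (NetOcc T S i)
  netOcc? T S i = occAt? T S i ×-dec ((2 ≤? f T S) ×-dec (leftOK? T S i ×-dec rightOK? T S i))

  -- φ(S): number of net occurrences of S in T (the string S is nonempty
  -- in all uses; start positions range over 0 .. |T|-1).
  φ : Str → Str → ℕ
  φ T S = length (filter (netOcc? T S) (upTo (length T)))

  -- Implicit suffix tree, via the trie of all suffixes of T.
  -- Trie nodes are the strings P that are prefixes of some suffix of T
  -- (i.e. occur in T); the children of P are the letters c with P c a trie node.

  TrieNode : Str → Str → Set
  TrieNode T P = 1 ≤ f T P

  numChildren : Str → Str → ℕ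
  numChildren T P = length (filter (λ c → 1 ≤? f T (P ∷ʳ c)) (allFin σ))

  Explicit : Str → Str → Set
  Explicit T P = TrieNode T P × ((P ≡ []) ⊎ (2 ≤ numChildren T P) ⊎ (numChildren T P ≡ 0))

  -- A node u of the implicit suffix tree is identified with str(u).
  -- The parent of u is its deepest explicit proper prefix, so
  -- depth(parent(u)) < d  iff  no prefix of str(u) of length k with d ≤ k < depth(u)
  -- is explicit.  (Locus T U d) says (u,d) is a locus, with str(u) = U.
  record Locus (T U : Str) (d : ℕ) : Set where
    field
      node-explicit : Explicit T U
      node-nonroot  : U ≢ []
      d-positive    : 1 ≤ d
      d≤depth       : d ≤ length U
      parent<d      : ∀ k → d ≤ k → k < length U → ¬ Explicit T (take k U)

  locusStr : Str → ℕ → Str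
  locusStr U d = take d U

  ImplicitNode : Str → Str → ℕ → Set
  ImplicitNode T U d = Locus T U d × RepeatedSuffix T (locusStr U d)

-- Let S = T[k..] be a repeated suffix which is not the longest one. Its
-- two occurrences force k > 0, and any longer repeated suffix ends with
-- bS, where b = T[k-1]; so the left extension bS is repeated too. Now take
-- an occurrence of S at i. If it ends at the end of T, it is the suffix
-- occurrence, whose left extension bS is not unique. Otherwise its right
-- extension Sc is unique; since (u,d) lies strictly inside an edge, S has a
-- single child c, so every other non-final occurrence of S would also be
-- followed by c: all occurrences of S are at i or at k. The two occurrences
-- of bS give two occurrences of S, at most one of them at k, so one of them
-- is at i, and again the left extension at i is the repeated bS. Hence no
-- occurrence of S is net.
module Submission where

open import Defs
open import Data.Nat using (ℕ; zero; suc; _+_; _∸_; _≤_; _<_; _≤?_; z≤n; s≤s)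
import Data.Nat as ℕ
open import Data.Nat.Properties
open import Data.Fin using (Fin)
import Data.Fin as F
open import Data.List using (List; []; _∷_; _∷ʳ_; _++_; length; take; drop; upTo)
open import Data.List.Properties using (length-++; ++-assoc; ++-identityʳ; ++-conicalˡ; ++-conicalʳ; take++drop≡id; drop-drop; filter-none)
open import Data.List.Membership.Propositional using (_∈_)
open import Data.List.Membership.Propositional.Properties using (∈-upTo⁺; ∈-allFin; ∈-filter⁺; ∈-filter⁻)
open import Data.List.Relation.Unary.Any using (here; there)
open import Data.List.Relation.Unary.All using (_∷_; universal)
open import Data.List.Relation.Unary.AllPairs using (_∷_)
open import Data.List.Relation.Unary.Unique.Propositional using (Unique)
import Data.List.Relation.Unary.Unique.Propositional.Properties as Unique
open import Data.Product using (∃; ∃₂; _×_; _,_; proj₂)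
open import Data.Sum using (_⊎_; inj₁; inj₂)
open import Function using (_∘_)
open import Relation.Nullary using (¬_; yes; no; contradiction)
open import Relation.Nullary.Decidable using (decidable-stable)
open import Relation.Binary.PropositionalEquality

module _ {A : Set} where

  ∈⇒1≤length : ∀ {x : A} {xs} → x ∈ xs → 1 ≤ length xs
  ∈⇒1≤length {xs = _ ∷ _} _ = s≤s z≤n

  ∈-≢-∈⇒2≤length : ∀ {x y : A} {xs} → x ∈ xs → y ∈ xs → x ≢ y → 2 ≤ length xs
  ∈-≢-∈⇒2≤length (here refl) (here refl) x≢y = contradiction refl x≢y
  ∈-≢-∈⇒2≤length (here refl) (there y∈) _   = s≤s (∈⇒1≤length y∈)
  ∈-≢-∈⇒2≤length (there x∈) (here refl) _   = s≤s (∈⇒1≤length x∈)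
  ∈-≢-∈⇒2≤length (there x∈) (there y∈) x≢y = m≤n⇒m≤1+n (∈-≢-∈⇒2≤length x∈ y∈ x≢y)

  unique∧2≤length⇒distinct : ∀ {xs : List A} → Unique xs → 2 ≤ length xs →
                             ∃₂ λ x y → x ∈ xs × y ∈ xs × x ≢ y
  unique∧2≤length⇒distinct {x ∷ y ∷ _} ((x≢y ∷ _) ∷ _) _ =
    x , y , here refl , there (here refl) , x≢y
  unique∧2≤length⇒distinct {_ ∷ []} _ (s≤s ())

  take⁺-≢[] : ∀ {n} {xs : List A} → 1 ≤ n → xs ≢ [] → take n xs ≢ []
  take⁺-≢[] {suc n} {[]}    _ xs≢[] = contradiction refl xs≢[]
  take⁺-≢[] {suc n} {x ∷ xs} _ _    ()

  take-length-++ : ∀ (xs ys : List A) → take (length xs) (xs ++ ys) ≡ xs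
  take-length-++ []       ys = refl
  take-length-++ (x ∷ xs) ys = cong (x ∷_) (take-length-++ xs ys)

  drop-++ : ∀ t (xs ys : List A) → drop t xs ≢ [] → drop t (xs ++ ys) ≡ drop t xs ++ ys
  drop-++ zero    xs       ys _  = refl
  drop-++ (suc t) []       ys ne = contradiction refl ne
  drop-++ (suc t) (x ∷ xs) ys ne = drop-++ t xs ys ne

  +-length-drop : ∀ q (xs : List A) {ys} → drop q xs ≡ ys → ys ≢ [] → q + length ys ≡ length xs
  +-length-drop zero    xs       refl _  = refl
  +-length-drop (suc q) []       refl ne = contradiction refl ne
  +-length-drop (suc q) (x ∷ xs) eq   ne = cong suc (+-length-drop q xs eq ne)

  drop-suc⇒∷ : ∀ k (xs : List A) {ys} → drop (suc k) xs ≡ ys → ys ≢ [] →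
               ∃ λ b → drop k xs ≡ b ∷ ys
  drop-suc⇒∷ k       []       refl ne = contradiction refl ne
  drop-suc⇒∷ zero    (x ∷ xs) refl _  = x , refl
  drop-suc⇒∷ (suc k) (x ∷ xs) eq   ne = drop-suc⇒∷ k xs eq ne

module _ {σ : ℕ} where

  occAt-intro : ∀ {T P : List (Fin σ)} {q} suf → P ≢ [] → drop q T ≡ P ++ suf → OccAt T P q
  occAt-intro {T} {P} {q} suf P≢[] eq =
      trans (cong (take (length P)) eq) (take-length-++ P suf)
    , (begin
        q + length P                ≤⟨ +-monoʳ-≤ q (m≤m+n (length P) (length suf)) ⟩
        q + (length P + length suf) ≡⟨ cong (q +_) (sym (length-++ P)) ⟩
        q + length (P ++ suf)       ≡⟨ +-length-drop q T eq (P≢[] ∘ ++-conicalˡ P suf) ⟩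
        length T                    ∎)
    where open ≤-Reasoning

  occAt-elim : ∀ {T P : List (Fin σ)} {q} → OccAt T P q →
               drop q T ≡ P ++ drop (length P) (drop q T)
  occAt-elim {T} {P} {q} (prefix , _) =
    trans (sym (take++drop≡id (length P) (drop q T)))
          (cong (_++ drop (length P) (drop q T)) prefix)

  suffix-occAt : ∀ {T S : List (Fin σ)} {k} → drop k T ≡ S → S ≢ [] → OccAt T S k
  suffix-occAt {S = S} suffix S≢[] = occAt-intro [] S≢[] (trans suffix (sym (++-identityʳ S)))

  occAt-≤-suffix : ∀ {T S : List (Fin σ)} {k q} → drop k T ≡ S → S ≢ [] → OccAt T S q → q ≤ k
  occAt-≤-suffix {T} {S} {k} {q} suffix S≢[] (_ , fits) =
    +-cancelʳ-≤ (length S) q k (≤-trans fits (≤-reflexive (sym (+-length-drop k T suffix S≢[]))))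

  occAt-drop : ∀ {T P Q : List (Fin σ)} {q} t → OccAt T P q → drop t P ≡ Q → Q ≢ [] →
               OccAt T Q (q + t)
  occAt-drop {T} {P} {Q} {q} t occ dropP≡Q Q≢[] = occAt-intro suf Q≢[] (begin
      drop (q + t) T    ≡⟨ sym (drop-drop q t T) ⟩
      drop t (drop q T) ≡⟨ cong (drop t) (occAt-elim occ) ⟩
      drop t (P ++ suf) ≡⟨ drop-++ t P suf (Q≢[] ∘ trans (sym dropP≡Q)) ⟩
      drop t P ++ suf   ≡⟨ cong (_++ suf) dropP≡Q ⟩
      Q ++ suf          ∎)
    where open ≡-Reasoning
          suf = drop (length P) (drop q T)

  occAt-tail : ∀ {T S : List (Fin σ)} {b q} → OccAt T (b ∷ S) q → S ≢ [] → OccAt T S (suc q)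
  occAt-tail {T} {S} {q = q} occ S≢[] =
    subst (OccAt T S) (+-comm q 1) (occAt-drop 1 occ refl S≢[])

  occAt-∷ʳ : ∀ {T P : List (Fin σ)} {p} → OccAt T P p → P ≢ [] → p + length P ≢ length T →
             ∃ λ c → OccAt T (P ∷ʳ c) p
  occAt-∷ʳ {T} {P} {p} occ P≢[] ¬end with drop (length P) (drop p T) in rest
  ... | [] = contradiction
               (+-length-drop p T (trans (occAt-elim occ) (trans (cong (P ++_) rest) (++-identityʳ P))) P≢[])
               ¬end
  ... | c ∷ suf = c , occAt-intro suf (λ e → contradiction (++-conicalʳ P (c ∷ []) e) λ ()) (begin
      drop p T                        ≡⟨ occAt-elim occ ⟩
      P ++ drop (length P) (drop p T) ≡⟨ cong (P ++_) rest ⟩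
      P ++ c ∷ suf                    ≡⟨ sym (++-assoc P (c ∷ []) suf) ⟩
      (P ∷ʳ c) ++ suf                 ∎)
    where open ≡-Reasoning

  occAt-∷ʳ-take : ∀ {T P : List (Fin σ)} {c p} → OccAt T (P ∷ʳ c) p →
                  take (suc (length P)) (drop p T) ≡ P ∷ʳ c
  occAt-∷ʳ-take {T} {P} {c} {p} (prefix , _) =
    subst (λ n → take n (drop p T) ≡ P ∷ʳ c) (trans (length-++ P) (+-comm (length P) 1)) prefix

  occAt⇒∈-positions : ∀ {T P : List (Fin σ)} {q} → OccAt T P q → q ∈ upTo (suc (length T))
  occAt⇒∈-positions {P = P} {q} (_ , fits) = ∈-upTo⁺ (s≤s (≤-trans (m≤m+n q (length P)) fits))

  occAt⇒1≤f : ∀ {T P : List (Fin σ)} {q} → OccAt T P q → 1 ≤ f T P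
  occAt⇒1≤f {T} {P} occ = ∈⇒1≤length (∈-filter⁺ (occAt? T P) (occAt⇒∈-positions occ) occ)

  occAt₂⇒2≤f : ∀ {T P : List (Fin σ)} {q r} → OccAt T P q → OccAt T P r → q ≢ r → 2 ≤ f T P
  occAt₂⇒2≤f {T} {P} occ₁ occ₂ =
    ∈-≢-∈⇒2≤length (∈-filter⁺ (occAt? T P) (occAt⇒∈-positions occ₁) occ₁)
                   (∈-filter⁺ (occAt? T P) (occAt⇒∈-positions occ₂) occ₂)

  2≤f⇒occAt₂ : ∀ {T P : List (Fin σ)} → 2 ≤ f T P → ∃₂ λ q r → OccAt T P q × OccAt T P r × q ≢ r
  2≤f⇒occAt₂ {T} {P} repeated
    with q , r , q∈ , r∈ , q≢r ← unique∧2≤length⇒distinct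
           (Unique.filter⁺ (occAt? T P) (Unique.upTo⁺ (suc (length T)))) repeated
    = q , r , proj₂ (∈-filter⁻ (occAt? T P) q∈) , proj₂ (∈-filter⁻ (occAt? T P) r∈) , q≢r

  unique-continuation : ∀ {T S : List (Fin σ)} {x y p q} → ¬ 2 ≤ numChildren T S →
                        OccAt T (S ∷ʳ x) p → OccAt T (S ∷ʳ y) q → x ≡ y
  unique-continuation {T} {S} {x} {y} ¬branching occ₁ occ₂ = decidable-stable (x F.≟ y) λ x≢y →
    ¬branching (∈-≢-∈⇒2≤length
      (∈-filter⁺ (λ c → 1 ≤? f T (S ∷ʳ c)) (∈-allFin x) (occAt⇒1≤f occ₁))
      (∈-filter⁺ (λ c → 1 ≤? f T (S ∷ʳ c)) (∈-allFin y) (occAt⇒1≤f occ₂))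
      x≢y)

  repeated-suffix-preceded : ∀ {T S : List (Fin σ)} {k} → drop k T ≡ S → S ≢ [] → 2 ≤ f T S →
                             ∃₂ λ j b → drop j T ≡ b ∷ S
  repeated-suffix-preceded {T} {k = suc k} suffix S≢[] _ = k , drop-suc⇒∷ k T suffix S≢[]
  repeated-suffix-preceded {k = zero} suffix S≢[] repeated
    with q , r , occ₁ , occ₂ , q≢r ← 2≤f⇒occAt₂ repeated
    = contradiction (trans (n≤0⇒n≡0 (occAt-≤-suffix suffix S≢[] occ₁))
                           (sym (n≤0⇒n≡0 (occAt-≤-suffix suffix S≢[] occ₂))))
                    q≢r

  longer-repeated-suffix⇒∷-repeated : ∀ {T S S′ : List (Fin σ)} {j b} → drop j T ≡ b ∷ S →
                                      RepeatedSuffix T S′ → length S < length S′ → 2 ≤ f T (b ∷ S)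
  longer-repeated-suffix⇒∷-repeated {T} {S} {S′} {j} {b} suffix ((m , suffix′) , repeated′) longer
    with q , r , occ₁ , occ₂ , q≢r ← 2≤f⇒occAt₂ repeated′
    = occAt₂⇒2≤f (occAt-drop (j ∸ m) occ₁ dropS′≡bS (λ ()))
                 (occAt-drop (j ∸ m) occ₂ dropS′≡bS (λ ()))
                 (q≢r ∘ +-cancelʳ-≡ (j ∸ m) q r)
    where
      S′≢[] : S′ ≢ []
      S′≢[] refl = contradiction longer λ ()
      m≤j : m ≤ j
      m≤j = +-cancelʳ-≤ (suc (length S)) m j (≤-trans (+-monoʳ-≤ m longer) (≤-reflexive
              (trans (+-length-drop m T suffix′ S′≢[]) (sym (+-length-drop j T suffix (λ ()))))))
      dropS′≡bS : drop (j ∸ m) S′ ≡ b ∷ S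
      dropS′≡bS = begin
        drop (j ∸ m) S′         ≡⟨ cong (drop (j ∸ m)) (sym suffix′) ⟩
        drop (j ∸ m) (drop m T) ≡⟨ drop-drop m (j ∸ m) T ⟩
        drop (m + (j ∸ m)) T    ≡⟨ cong (λ n → drop n T) (m+[n∸m]≡n m≤j) ⟩
        drop j T                ≡⟨ suffix ⟩
        b ∷ S                   ∎
        where open ≡-Reasoning

  ¬longest⇒∷-repeated : ∀ {T S : List (Fin σ)} {j b} → drop j T ≡ b ∷ S → RepeatedSuffix T S →
                        ¬ LongestRepeatedSuffix T S → 2 ≤ f T (b ∷ S)
  ¬longest⇒∷-repeated {T} {S} {j} {b} suffix rep ¬longest with 2 ≤? f T (b ∷ S)
  ... | yes repeated = repeated
  ... | no ¬repeated = contradiction (rep , λ S′ rep′ →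
          ≮⇒≥ (¬repeated ∘ longer-repeated-suffix⇒∷-repeated {j = j} suffix rep′)) ¬longest

  ∷-repeated⇒¬leftOK : ∀ {T S : List (Fin σ)} {b j} → 2 ≤ f T (b ∷ S) →
                       OccAt T (b ∷ S) j → ¬ LeftOK T S (suc j)
  ∷-repeated⇒¬leftOK {T} repeated (prefix , _) unique =
    <⇒≢ repeated (sym (trans (cong (f T) (sym prefix)) unique))

  occAt-at-or-end : ∀ {T S : List (Fin σ)} {c i p} → ¬ 2 ≤ numChildren T S → S ≢ [] →
                    OccAt T (S ∷ʳ c) i → f T (S ∷ʳ c) ≡ 1 →
                    OccAt T S p → p ≡ i ⊎ p + length S ≡ length T
  occAt-at-or-end {T} {S} {c} {i} {p} ¬branching S≢[] occᵢ unique occ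
    with p + length S ℕ.≟ length T
  ... | yes end = inj₂ end
  ... | no ¬end with x , occₚ ← occAt-∷ʳ occ S≢[] ¬end
    = inj₁ (decidable-stable (p ℕ.≟ i) λ p≢i →
              <⇒≢ (occAt₂⇒2≤f occₚc occᵢ p≢i) (sym unique))
    where
      occₚc : OccAt T (S ∷ʳ c) p
      occₚc = subst (λ y → OccAt T (S ∷ʳ y) p) (unique-continuation ¬branching occₚ occᵢ) occₚ

  unique-right-extension⇒preceded :
    ∀ {T S : List (Fin σ)} {b c i} → ¬ 2 ≤ numChildren T S → S ≢ [] →
    2 ≤ f T (b ∷ S) → OccAt T (S ∷ʳ c) i → f T (S ∷ʳ c) ≡ 1 →
    ∃ λ j′ → i ≡ suc j′ × OccAt T (b ∷ S) j′
  unique-right-extension⇒preceded {T} {S} ¬branching S≢[] repeated occᵢ unique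
    with j₁ , j₂ , occ₁ , occ₂ , j₁≢j₂ ← 2≤f⇒occAt₂ repeated
    with occAt-at-or-end ¬branching S≢[] occᵢ unique (occAt-tail occ₁ S≢[])
       | occAt-at-or-end ¬branching S≢[] occᵢ unique (occAt-tail occ₂ S≢[])
  ... | inj₁ at   | _         = j₁ , sym at , occ₁
  ... | inj₂ _    | inj₁ at   = j₂ , sym at , occ₂
  ... | inj₂ end₁ | inj₂ end₂ = contradiction
          (suc-injective (+-cancelʳ-≡ (length S) (suc j₁) (suc j₂) (trans end₁ (sym end₂)))) j₁≢j₂

  rightOK⇒preceded : ∀ {T S : List (Fin σ)} {j b i} → S ≢ [] → drop j T ≡ b ∷ S →
                     2 ≤ f T (b ∷ S) → ¬ 2 ≤ numChildren T S → OccAt T S i → RightOK T S i →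
                     ∃ λ j′ → i ≡ suc j′ × OccAt T (b ∷ S) j′
  rightOK⇒preceded {T} {S} {j} {b} {i} S≢[] suffix repeated ¬branching occᵢ right
    with i + length S ℕ.≟ length T | right
  ... | yes end | _ = j , +-cancelʳ-≡ (length S) i (suc j) (trans end (sym suffix-end))
                        , suffix-occAt suffix (λ ())
    where
      suffix-end : suc j + length S ≡ length T
      suffix-end = trans (sym (+-suc j (length S))) (+-length-drop j T suffix (λ ()))
  ... | no ¬end | inj₁ end = contradiction end ¬end
  ... | no ¬end | inj₂ unique with c , occᵢc ← occAt-∷ʳ occᵢ S≢[] ¬end
    = unique-right-extension⇒preceded ¬branching S≢[] repeated occᵢc
        (trans (cong (f T) (sym (occAt-∷ʳ-take occᵢc))) unique)

  ¬netOcc : ∀ {T S : List (Fin σ)} {j b} → S ≢ [] → drop j T ≡ b ∷ S →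
            2 ≤ f T (b ∷ S) → ¬ 2 ≤ numChildren T S → ∀ i → ¬ NetOcc T S i
  ¬netOcc {j = j} S≢[] suffix repeated ¬branching i (occ , _ , left , right)
    with j′ , refl , occ′ ← rightOK⇒preceded {j = j} S≢[] suffix repeated ¬branching occ right
    = ∷-repeated⇒¬leftOK repeated occ′ left

  ¬netOcc⇒φ≡0 : ∀ {T S : List (Fin σ)} → (∀ i → ¬ NetOcc T S i) → φ T S ≡ 0
  ¬netOcc⇒φ≡0 {T} {S} ¬net = cong length (filter-none (netOcc? T S) (universal ¬net (upTo (length T))))

lemma6 : {σ : ℕ} (T U : List (Fin σ)) (d : ℕ) →
    ImplicitNode T U d →
    ¬ LongestRepeatedSuffix T (locusStr U d) →
    d < length U →
    φ T (locusStr U d) ≡ 0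
lemma6 {σ} T U d (locus , rep@((k , suffix) , repeated)) ¬longest d<|U| =
  let j , _ , suffix′ = repeated-suffix-preceded {k = k} suffix S≢[] repeated
  in ¬netOcc⇒φ≡0 (¬netOcc {j = j} S≢[] suffix′ (¬longest⇒∷-repeated {j = j} suffix′ rep ¬longest) ¬branching)
  where
    open Locus locus
    S : List (Fin σ)
    S = locusStr U d
    S≢[] : S ≢ []
    S≢[] = take⁺-≢[] d-positive node-nonroot
    ¬branching : ¬ 2 ≤ numChildren T S
    ¬branching branching =
      parent<d d ≤-refl d<|U| (≤-trans (s≤s z≤n) repeated , inj₂ (inj₁ branching))
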